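{- Let $q\geq 2$ be an integer. For every rational number $r$ with $0<r<1$ there exists $u\in\mathbb{N}$ such that \[ \frac{s_q(u^2)}{s_q(u)}=r. \]
   Context: For an integer $q\geq 2$ and $n\in\mathbb{N}$, $s_q(n)$ denotes the sum of the digits of $n$ written in base $q$. -}

module Defs where

open import Data.Nat using (ℕ; zero; suc; _+_; _/_; _%_; _≤_)


-- Sum of base-q digits of n (for q ≥ 2), with fuel: each step divides by q,
-- so fuel n suffices (n / q < n for n ≥ 1, q ≥ 2).
digitSumAux : (q : ℕ) → .{{_ : Data.Nat.NonZero q}} → ℕ → ℕ → ℕ
digitSumAux q zero    n = 0
digitSumAux q (suc k) zero = 0
digitSumAux q (suc k) (suc n) = (suc n % q) + digitSumAux q k (suc n / q)

s : (q : ℕ) → .{{_ : Data.Nat.NonZero q}} → ℕ → ℕ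
s q n = digitSumAux q n n

-- Write t = q - 1 and W_M = q^M - 1 (M digits t). The digit sums of multiples of W_M
-- are explicit: s(v·W_M) = Mt for 1 ≤ v ≤ q^M, and s(c·W_M²) = Mt + s(c-1) + s(c) - s(2c-1)
-- for 2c ≤ q^M, because these numbers are concatenations of complementary digit strings.
-- Take a = W_M₁, b = W_M₂ and a large base X = q^L, and let
--     u = a·P(X) + X⁹·b·(1 + X),   P(X) = 1 + 2X - X² + 2X³ + X⁴.
-- The negative coefficient is paid for by a block X - a in u, whose digit sum ≈ Lt grows
-- with L, whereas P², 2P(1+X) and (1+X)² have small non-negative coefficients, so u² is
-- made of the blocks c·a², c·ab, c·b² only and s(u²) ≈ (7M₁ + 9M₂)t does not involve L.
-- Exactly: s(u) = t(L + 3M₁ + 2M₂ + j(2)) and s(u²) = t(7M₁ + 9M₂ + Q - P), with constants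
-- P, Q, j(2) depending only on q. Since gcd(7, 9) = 1, suitable M₁, M₂, L make
-- s(u²) : s(u) = n : d for any 0 < n < d.
module Submission where

open import Defs

module DigitSumsOfSquares where

  open import Data.Nat using (ℕ; zero; suc; >-nonZero; _+_; _*_; _∸_; _^_; _≤_; _<_; z≤n; s≤s; _/_; _%_; pred)
  open import Data.Nat.Properties
  open import Data.Nat.DivMod
  open import Data.Nat.Divisibility using (n∣m*n)
  open import Data.Nat.Tactic.RingSolver using (solve-∀)
  open import Data.List using (List; []; _∷_; _++_; map; length)
  open import Data.List.Properties using (map-++)
  open import Data.Nat.ListAction using (sum)
  open import Data.Nat.ListAction.Properties using (sum-++)
  open import Data.List.Relation.Unary.All using (All; []; _∷_; all?) renaming (map to All-map)
  open import Data.List.Relation.Unary.All.Properties using (++⁺; map⁺)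
  open import Relation.Nullary.Decidable using (from-yes)
  open import Data.Product using (∃; _×_; _,_; proj₁; proj₂)
  open import Relation.Binary.PropositionalEquality

  evalP : ℕ → List ℕ → ℕ
  evalP X []       = 0
  evalP X (c ∷ cs) = c + X * evalP X cs

  evalP-++ : ∀ X xs ys → evalP X (xs ++ ys) ≡ evalP X xs + X ^ length xs * evalP X ys
  evalP-++ X []       ys = sym (+-identityʳ _)
  evalP-++ X (x ∷ xs) ys = begin
      x + X * evalP X (xs ++ ys)
    ≡⟨ cong (λ v → x + X * v) (evalP-++ X xs ys) ⟩
      x + X * (evalP X xs + X ^ length xs * evalP X ys)
    ≡⟨ distribute x X (evalP X xs) (X ^ length xs) (evalP X ys) ⟩
      (x + X * evalP X xs) + X * X ^ length xs * evalP X ys ∎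
    where
    open ≡-Reasoning
    distribute : ∀ x X p Y r → x + X * (p + Y * r) ≡ (x + X * p) + X * Y * r
    distribute = solve-∀

  scale : ℕ → List ℕ → List ℕ
  scale m = map (_* m)

  nonzeros : List ℕ → ℕ
  nonzeros []           = 0
  nonzeros (zero  ∷ cs) = nonzeros cs
  nonzeros (suc _ ∷ cs) = suc (nonzeros cs)

  sum-map-++ : ∀ (f : ℕ → ℕ) xs ys → sum (map f (xs ++ ys)) ≡ sum (map f xs) + sum (map f ys)
  sum-map-++ f xs ys = trans (cong sum (map-++ f xs ys)) (sum-++ (map f xs) (map f ys))

  evalP-scale : ∀ X m cs → evalP X (scale m cs) ≡ m * evalP X cs
  evalP-scale X m []       = sym (*-zeroʳ m)
  evalP-scale X m (c ∷ cs) = begin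
      c * m + X * evalP X (scale m cs)
    ≡⟨ cong (λ v → c * m + X * v) (evalP-scale X m cs) ⟩
      c * m + X * (m * evalP X cs)
    ≡⟨ distribute c m X (evalP X cs) ⟩
      m * (c + X * evalP X cs) ∎
    where
    open ≡-Reasoning
    distribute : ∀ c m X p → c * m + X * (m * p) ≡ m * (c + X * p)
    distribute = solve-∀

  -- P(X) = 1 + 2X - X² + 2X³ + X⁴ has a negative coefficient, yet the polynomials
  -- P(X)², 2P(X)(1 + X) and (1 + X)² have small non-negative coefficients:
  P²Coeffs crossCoeffs tailCoeffs : List ℕ
  P²Coeffs    = 1 ∷ 4 ∷ 2 ∷ 0 ∷ 11 ∷ 0 ∷ 2 ∷ 4 ∷ 1 ∷ []
  crossCoeffs = 2 ∷ 6 ∷ 2 ∷ 2 ∷ 6 ∷ 2 ∷ 0 ∷ 0 ∷ 0 ∷ []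
  tailCoeffs  = 1 ∷ 2 ∷ 1 ∷ []

  -- Base-X blocks of u = a·P(X) + X⁹·b·(1 + X), where a = a' + 1 and X = e + a.
  -- The coefficient -a of X² is realised by borrowing: -aX² = eX² - X³.
  lowBlocks : ℕ → ℕ → ℕ → List ℕ
  lowBlocks a a' e = a ∷ 2 * a ∷ e ∷ suc (2 * a') ∷ a ∷ 0 ∷ 0 ∷ 0 ∷ 0 ∷ []

  uBlocks : ℕ → ℕ → ℕ → ℕ → List ℕ
  uBlocks a a' e b = lowBlocks a a' e ++ (b ∷ b ∷ [])

  -- Base-X blocks of u² = a²·P(X)² + X⁹·(ab·2P(X)(1 + X) + X⁹·b²·(1 + X)²).
  u²Blocks : ℕ → ℕ → List ℕ
  u²Blocks a b = scale (a * a) P²Coeffs ++ (scale (a * b) crossCoeffs ++ scale (b * b) tailCoeffs)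

  u²-blocks : ∀ a a' e b X → a ≡ suc a' → X ≡ e + a →
    evalP X (uBlocks a a' e b) * evalP X (uBlocks a a' e b) ≡ evalP X (u²Blocks a b)
  u²-blocks .(suc a') a' e b .(e + suc a') refl refl = begin
      evalP X (uBlocks a a' e b) * evalP X (uBlocks a a' e b)
    ≡⟨ cong (λ u → u * u) (evalP-++ X (lowBlocks a a' e) (b ∷ b ∷ [])) ⟩
      (A + X ^ 9 * B) * (A + X ^ 9 * B)
    ≡⟨ square-sum A B (X ^ 9) ⟩
      A * A + X ^ 9 * (2 * A * B + X ^ 9 * (B * B))
    ≡⟨ cong₂ (λ u v → u + X ^ 9 * v) (A² a' e) (cong₂ (λ u v → u + X ^ 9 * v) (2AB a' e b) (B² b X)) ⟩
      a * a * evalP X P²Coeffs + X ^ 9 * (a * b * evalP X crossCoeffs + X ^ 9 * (b * b * evalP X tailCoeffs))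
    ≡⟨ sym (cong₂ (λ u v → u + X ^ 9 * v) (evalP-scale X (a * a) P²Coeffs)
         (trans (evalP-++ X (scale (a * b) crossCoeffs) (scale (b * b) tailCoeffs))
                (cong₂ (λ u v → u + X ^ 9 * v) (evalP-scale X (a * b) crossCoeffs) (evalP-scale X (b * b) tailCoeffs)))) ⟩
      evalP X (scale (a * a) P²Coeffs) + X ^ 9 * evalP X (scale (a * b) crossCoeffs ++ scale (b * b) tailCoeffs)
    ≡⟨ sym (evalP-++ X (scale (a * a) P²Coeffs) (scale (a * b) crossCoeffs ++ scale (b * b) tailCoeffs)) ⟩
      evalP X (u²Blocks a b) ∎
    where
    open ≡-Reasoning
    a = suc a'
    X = e + suc a'
    A = evalP X (lowBlocks a a' e)
    B = evalP X (b ∷ b ∷ [])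
    square-sum : ∀ A B Y → (A + Y * B) * (A + Y * B) ≡ A * A + Y * (2 * A * B + Y * (B * B))
    square-sum = solve-∀
    A² : ∀ a' e → let a = suc a' ; X = e + suc a' in
      (a + X * (2 * a + X * (e + X * (suc (2 * a') + X * (a + X * (0 + X * (0 + X * (0 + X * (0 + X * 0))))))))) *
      (a + X * (2 * a + X * (e + X * (suc (2 * a') + X * (a + X * (0 + X * (0 + X * (0 + X * (0 + X * 0)))))))))
      ≡ a * a * (1 + X * (4 + X * (2 + X * (0 + X * (11 + X * (0 + X * (2 + X * (4 + X * (1 + X * 0)))))))))
    A² = solve-∀
    2AB : ∀ a' e b → let a = suc a' ; X = e + suc a' in
      2 * (a + X * (2 * a + X * (e + X * (suc (2 * a') + X * (a + X * (0 + X * (0 + X * (0 + X * (0 + X * 0))))))))) *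
      (b + X * (b + X * 0))
      ≡ a * b * (2 + X * (6 + X * (2 + X * (2 + X * (6 + X * (2 + X * (0 + X * (0 + X * (0 + X * 0)))))))))
    2AB = solve-∀
    B² : ∀ b X → (b + X * (b + X * 0)) * (b + X * (b + X * 0)) ≡ b * b * (1 + X * (2 + X * (1 + X * 0)))
    B² = solve-∀

  ≤-by-difference : ∀ {m n} k → m + k ≡ n → m ≤ n
  ≤-by-difference {m} k m+k≡n = subst (m ≤_) m+k≡n (m≤m+n m k)

  -- Lengths M₁, M₂, L and a common factor N realising the ratio n/d, for the given
  -- correction constants P, Q and c (see 'Construction' below).
  record Lengths (P Q c n d : ℕ) : Set where
    field
      M₁ M₂ L N : ℕ
      5≤M₁      : 5 ≤ M₁
      M₁+3≤M₂   : M₁ + 3 ≤ M₂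
      2M₂+4≤L   : 2 * M₂ + 4 ≤ L
      1≤N       : 1 ≤ N
      square-eq : 7 * M₁ + 9 * M₂ + Q ≡ P + n * N
      root-eq   : L + 3 * M₁ + 2 * M₂ + c ≡ d * N

  -- Since 7·4 - 9·3 = 1, the value 7M₁ + 9M₂ can be steered to any large target: with
  -- x = P + (n-1)Q, the choice M₁ = 4x + 5n, M₂ = 3x(n-1) + nβ solves the first equation;
  -- L is then whatever the second equation leaves over, which is large since d > n.
  choose-lengths : ∀ P Q c n d → c ≤ 2 → 0 < n → n < d → Lengths P Q c n d
  choose-lengths P Q c (suc n') d c≤2 _ n<d = record
    { M₁ = M₁ ; M₂ = M₂ ; L = L ; N = N
    ; 5≤M₁      = ≤-by-difference (4 * x + 5 * n') (M₁-eq P Q n')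
    ; M₁+3≤M₂   = ≤-by-difference (7 * x * n' + 3 * n' + P + P * n') (M₂-eq P Q n')
    ; 2M₂+4≤L   = ≤-by-difference (4 * M₁ + 5 * M₂ + Q + d' * N + (Q + 63 * x + 101 + 8 * P + (2 ∸ c))) (L-eq M₁ M₂ Q d' N x P (2 ∸ c))
    ; 1≤N       = s≤s z≤n
    ; square-eq = square P Q n'
    ; root-eq   = +-cancelʳ-≡ 2 _ _ (begin
          L + 3 * M₁ + 2 * M₂ + c + 2
        ≡⟨ root P Q n' d' (2 ∸ c) c ⟩
          (suc n' + suc d') * N + (2 ∸ c + c)
        ≡⟨ cong₂ (λ u v → u * N + v) (sym d≡n+1+d') (m∸n+n≡m c≤2) ⟩
          d * N + 2 ∎)
    }
    where
    open ≡-Reasoning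
    d' x β M₁ M₂ N L : ℕ
    d' = d ∸ suc (suc n')
    d≡n+1+d' : d ≡ suc n' + suc d'
    d≡n+1+d' = trans (sym (m+[n∸m]≡n n<d)) (sym (+-suc (suc n') d'))
    x  = P + n' * Q
    β  = 4 * x + 8 + P
    M₁ = 4 * x + 5 * suc n'
    M₂ = 3 * x * n' + suc n' * β
    N  = suc (Q + 27 * x + 34 + 9 * β)
    L  = 4 * M₁ + 7 * M₂ + Q + d' * N + (Q + 63 * x + 105 + 8 * P + (2 ∸ c))
    M₁-eq : ∀ P Q n → let x = P + n * Q in 5 + (4 * x + 5 * n) ≡ 4 * x + 5 * suc n
    M₁-eq = solve-∀
    M₂-eq : ∀ P Q n → let x = P + n * Q in
      (4 * x + 5 * suc n + 3) + (7 * x * n + 3 * n + P + P * n) ≡ 3 * x * n + suc n * (4 * x + 8 + P)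
    M₂-eq = solve-∀
    L-eq : ∀ M₁ M₂ Q d N x P r → (2 * M₂ + 4) + (4 * M₁ + 5 * M₂ + Q + d * N + (Q + 63 * x + 101 + 8 * P + r))
           ≡ 4 * M₁ + 7 * M₂ + Q + d * N + (Q + 63 * x + 105 + 8 * P + r)
    L-eq = solve-∀
    square : ∀ P Q n → let x = P + n * Q ; β = 4 * x + 8 + P in
      7 * (4 * x + 5 * suc n) + 9 * (3 * x * n + suc n * β) + Q ≡ P + suc n * suc (Q + 27 * x + 34 + 9 * β)
    square = solve-∀
    root : ∀ P Q n d r c →
      let x  = P + n * Q
          β  = 4 * x + 8 + P
          M₁ = 4 * x + 5 * suc n
          M₂ = 3 * x * n + suc n * β
          N  = suc (Q + 27 * x + 34 + 9 * β)
      in (4 * M₁ + 7 * M₂ + Q + d * N + (Q + 63 * x + 105 + 8 * P + r)) + 3 * M₁ + 2 * M₂ + c + 2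
         ≡ (suc n + suc d) * N + (r + c)
    root = solve-∀

  module DigitSums (k : ℕ) where

    q t : ℕ
    q = suc (suc k)
    t = suc k

    S : ℕ → ℕ
    S = s q

    1<q : 1 < q
    1<q = s≤s (s≤s z≤n)

    fuel-suc : ∀ f n → n ≤ f → digitSumAux q f n ≡ digitSumAux q (suc f) n
    fuel-suc zero    zero    _         = refl
    fuel-suc (suc f) zero    _         = refl
    fuel-suc (suc f) (suc m) (s≤s m≤f) =
      cong (suc m % q +_) (fuel-suc f (suc m / q) (≤-trans (≤-pred (m/n<m (suc m) q 1<q)) m≤f))

    enough-fuel : ∀ f n → n ≤ f → digitSumAux q f n ≡ S n
    enough-fuel f n n≤f = begin
        digitSumAux q f n
      ≡⟨ cong (λ g → digitSumAux q g n) (sym (m∸n+n≡m n≤f)) ⟩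
        digitSumAux q ((f ∸ n) + n) n
      ≡⟨ extra (f ∸ n) ⟩
        S n ∎
      where
      open ≡-Reasoning
      extra : ∀ d → digitSumAux q (d + n) n ≡ S n
      extra zero    = refl
      extra (suc d) = trans (sym (fuel-suc (d + n) n (m≤n+m n d))) (extra d)

    s-step : ∀ n → S n ≡ n % q + S (n / q)
    s-step zero    = refl
    s-step (suc m) = cong (suc m % q +_) (enough-fuel m (suc m / q) (≤-pred (m/n<m (suc m) q 1<q)))

    s-digit : ∀ d y → d < q → S (d + y * q) ≡ d + S y
    s-digit d y d<q = begin
        S (d + y * q)
      ≡⟨ s-step (d + y * q) ⟩
        (d + y * q) % q + S ((d + y * q) / q)
      ≡⟨ cong₂ (λ a b → a + S b) last-digit rest ⟩
        d + S y ∎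
      where
      open ≡-Reasoning
      last-digit : (d + y * q) % q ≡ d
      last-digit = trans ([m+kn]%n≡m%n d y q) (m<n⇒m%n≡m d<q)
      rest : (d + y * q) / q ≡ y
      rest = begin
          (d + y * q) / q
        ≡⟨ +-distrib-/-∣ʳ d (n∣m*n y) ⟩
          d / q + y * q / q
        ≡⟨ cong₂ _+_ (m<n⇒m/n≡0 d<q) (m*n/n≡m y q) ⟩
          y ∎

    s-concat : ∀ L x y → x < q ^ L → S (x + q ^ L * y) ≡ S x + S y
    s-concat zero    zero    y _        = cong S (*-identityˡ y)
    s-concat zero    (suc x) y (s≤s ())
    s-concat (suc L) x       y x<q^1+L = begin
        S (x + q ^ suc L * y)
      ≡⟨ cong (λ z → S (z + q ^ suc L * y)) (m≡m%n+[m/n]*n x q) ⟩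
        S ((x % q + x / q * q) + q * q ^ L * y)
      ≡⟨ cong S (regroup (x % q) (x / q) (q ^ L) y q) ⟩
        S (x % q + (x / q + q ^ L * y) * q)
      ≡⟨ s-digit (x % q) (x / q + q ^ L * y) (m%n<n x q) ⟩
        x % q + S (x / q + q ^ L * y)
      ≡⟨ cong (x % q +_) (s-concat L (x / q) y (m<n*o⇒m/o<n (subst (x <_) (*-comm q (q ^ L)) x<q^1+L))) ⟩
        x % q + (S (x / q) + S y)
      ≡⟨ sym (+-assoc (x % q) _ _) ⟩
        (x % q + S (x / q)) + S y
      ≡⟨ cong (_+ S y) (sym (s-step x)) ⟩
        S x + S y ∎
      where
      open ≡-Reasoning
      regroup : ∀ x₀ x₁ Q y b → (x₀ + x₁ * b) + b * Q * y ≡ x₀ + (x₁ + Q * y) * b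
      regroup = solve-∀

    s-congruence : ∀ m → ∃ λ j → S m + t * j ≡ m
    s-congruence m = go m m ≤-refl
      where
      go : ∀ f m → m ≤ f → ∃ λ j → S m + t * j ≡ m
      go f       zero    _         = 0 , *-zeroʳ t
      go (suc f) (suc m) (s≤s m≤f) with go f (suc m / q) (≤-trans (≤-pred (m/n<m (suc m) q 1<q)) m≤f)
      ... | j , S[m/q]+tj≡m/q = j + suc m / q , (begin
          S (suc m) + t * (j + m₁)
        ≡⟨ cong (_+ t * (j + m₁)) (s-step (suc m)) ⟩
          (m₀ + S m₁) + t * (j + m₁)
        ≡⟨ regroup m₀ (S m₁) t j m₁ ⟩
          m₀ + (S m₁ + t * j) + t * m₁
        ≡⟨ cong (λ z → m₀ + z + t * m₁) S[m/q]+tj≡m/q ⟩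
          m₀ + m₁ + t * m₁
        ≡⟨ base m₀ m₁ k ⟩
          m₀ + m₁ * q
        ≡⟨ sym (m≡m%n+[m/n]*n (suc m) q) ⟩
          suc m ∎)
        where
        open ≡-Reasoning
        m₀ = suc m % q
        m₁ = suc m / q
        regroup : ∀ a b t j d → (a + b) + t * (j + d) ≡ a + (b + t * j) + t * d
        regroup = solve-∀
        base : ∀ a d k → a + d + suc k * d ≡ a + d * suc (suc k)
        base = solve-∀

    -- The quotient j(m) = (m - s_q(m)) / (q - 1).
    j : ℕ → ℕ
    j m = proj₁ (s-congruence m)

    s+tj≡id : ∀ m → S m + t * j m ≡ m
    s+tj≡id m = proj₂ (s-congruence m)

    -- Only j(2) ≤ 2 is needed, to keep the length L non-negative.
    j≤id : ∀ m → j m ≤ m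
    j≤id m = begin
        j m       ≤⟨ m≤n*m (j m) t ⟩
        t * j m   ≤⟨ m≤n+m (t * j m) (S m) ⟩
        S m + t * j m ≡⟨ s+tj≡id m ⟩
        m ∎
      where open ≤-Reasoning

    W : ℕ → ℕ
    W M = pred (q ^ M)

    q^M≡1+W : ∀ M → q ^ M ≡ suc (W M)
    q^M≡1+W M = sym (suc-pred (q ^ M) {{>-nonZero (m^n>0 q M)}})

    W-suc : ∀ M → W (suc M) ≡ t + W M * q
    W-suc M = cong pred (begin
        q * q ^ M        ≡⟨ cong (q *_) (q^M≡1+W M) ⟩
        q * suc (W M)    ≡⟨ expand k (W M) ⟩
        suc (t + W M * q) ∎)
      where
      open ≡-Reasoning
      expand : ∀ k w → suc (suc k) * suc w ≡ suc (suc k + w * suc (suc k))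
      expand = solve-∀

    s-W : ∀ M → S (W M) ≡ M * t
    s-W zero    = refl
    s-W (suc M) = begin
        S (W (suc M))     ≡⟨ cong S (W-suc M) ⟩
        S (t + W M * q)   ≡⟨ s-digit t (W M) ≤-refl ⟩
        t + S (W M)       ≡⟨ cong (t +_) (s-W M) ⟩
        t + M * t ∎
      where open ≡-Reasoning

    -- Subtracting from W M never borrows, so the digit sums of x and W M - x add up
    -- to that of W M.
    s-complement-∸ : ∀ M x → x ≤ W M → S (W M ∸ x) + S x ≡ M * t
    s-complement-∸ zero    zero _   = refl
    s-complement-∸ (suc M) x  x≤W = begin
        S (W (suc M) ∸ x) + S x
      ≡⟨ cong₂ (λ u v → S (u ∸ v) + S v) (W-suc M) (m≡m%n+[m/n]*n x q) ⟩
        S ((t + W M * q) ∸ (x₀ + x₁ * q)) + S (x₀ + x₁ * q)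
      ≡⟨ cong (λ u → S u + S (x₀ + x₁ * q)) (digitwise-∸ x₀≤t x₁≤W) ⟩
        S ((t ∸ x₀) + (W M ∸ x₁) * q) + S (x₀ + x₁ * q)
      ≡⟨ cong₂ _+_ (s-digit (t ∸ x₀) (W M ∸ x₁) (s≤s (m∸n≤m t x₀))) (s-digit x₀ x₁ (m%n<n x q)) ⟩
        ((t ∸ x₀) + S (W M ∸ x₁)) + (x₀ + S x₁)
      ≡⟨ +-comm-middle (t ∸ x₀) (S (W M ∸ x₁)) x₀ (S x₁) ⟩
        ((t ∸ x₀) + x₀) + (S (W M ∸ x₁) + S x₁)
      ≡⟨ cong₂ _+_ (m∸n+n≡m x₀≤t) (s-complement-∸ M x₁ x₁≤W) ⟩
        t + M * t ∎
      where
      open ≡-Reasoning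
      x₀ = x % q
      x₁ = x / q
      x₀≤t : x₀ ≤ t
      x₀≤t = ≤-pred (m%n<n x q)
      x₁≤W : x₁ ≤ W M
      x₁≤W = ≤-pred (subst (x₁ <_) (q^M≡1+W M) (m<n*o⇒m/o<n x<q^M*q))
        where
        x<q^M*q : x < q ^ M * q
        x<q^M*q = subst (x <_) (trans (sym (q^M≡1+W (suc M))) (*-comm q (q ^ M))) (s≤s x≤W)
      digitwise-∸ : ∀ {a b c d} → a ≤ c → b ≤ d → (c + d * q) ∸ (a + b * q) ≡ (c ∸ a) + (d ∸ b) * q
      digitwise-∸ {a} {b} {c} {d} a≤c b≤d = begin
          (c + d * q) ∸ (a + b * q)
        ≡⟨ cong₂ (λ u v → (u + v * q) ∸ (a + b * q)) (sym (m+[n∸m]≡n a≤c)) (sym (m+[n∸m]≡n b≤d)) ⟩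
          ((a + (c ∸ a)) + (b + (d ∸ b)) * q) ∸ (a + b * q)
        ≡⟨ cong (_∸ (a + b * q)) (split a (c ∸ a) b (d ∸ b) q) ⟩
          ((a + b * q) + ((c ∸ a) + (d ∸ b) * q)) ∸ (a + b * q)
        ≡⟨ m+n∸m≡n (a + b * q) _ ⟩
          (c ∸ a) + (d ∸ b) * q ∎
        where
        split : ∀ a c' b d' r → (a + c') + (b + d') * r ≡ (a + b * r) + (c' + d' * r)
        split = solve-∀
      +-comm-middle : ∀ a b c d → (a + b) + (c + d) ≡ (a + c) + (b + d)
      +-comm-middle = solve-∀

    s-complement : ∀ M x y → x + y ≡ W M → S x + S y ≡ M * t
    s-complement M x y x+y≡W = begin
        S x + S y              ≡⟨ +-comm (S x) (S y) ⟩
        S y + S x              ≡⟨ cong (λ u → S u + S x) y≡W∸x ⟩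
        S (W M ∸ x) + S x      ≡⟨ s-complement-∸ M x (subst (x ≤_) x+y≡W (m≤m+n x y)) ⟩
        M * t ∎
      where
      open ≡-Reasoning
      y≡W∸x : y ≡ W M ∸ x
      y≡W∸x = sym (trans (cong (_∸ x) (sym x+y≡W)) (m+n∸m≡n x y))

    -- A multiple v·(q^M - 1) with 1 ≤ v ≤ q^M is the concatenation of q^M - v and
    -- v - 1, which are complementary; hence its digit sum is M(q-1).
    s-multiple-W : ∀ M v → 1 ≤ v → v ≤ q ^ M → S (v * W M) ≡ M * t
    s-multiple-W M (suc v) _ 1+v≤q^M = begin
        S (suc v * W M)
      ≡⟨ cong (λ u → S (suc v * u)) (sym (m∸n+n≡m v≤W)) ⟩
        S (suc v * (w + v))
      ≡⟨ cong S (split v w) ⟩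
        S (w + suc (w + v) * v)
      ≡⟨ cong (λ u → S (w + u * v)) (trans (cong suc (m∸n+n≡m v≤W)) (sym (q^M≡1+W M))) ⟩
        S (w + q ^ M * v)
      ≡⟨ s-concat M w v (subst (w <_) (sym (q^M≡1+W M)) (s≤s (m∸n≤m (W M) v))) ⟩
        S w + S v
      ≡⟨ s-complement-∸ M v v≤W ⟩
        M * t ∎
      where
      open ≡-Reasoning
      v≤W : v ≤ W M
      v≤W = ≤-pred (subst (suc v ≤_) (q^M≡1+W M) 1+v≤q^M)
      w = W M ∸ v
      split : ∀ v w → suc v * (w + v) ≡ w + suc (w + v) * v
      split = solve-∀

    -- For c = c' + 1 with 2c ≤ q^M:  c·(q^M - 1)² = c + q^M·(z + q^M·c') with
    -- z = q^M - 2c, and z is complementary to 2c - 1; hence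
    -- s(c·W²) + s(2c - 1) = s(c - 1) + M(q-1) + s(c).
    s-multiple-W² : ∀ M c' → 2 * suc c' ≤ q ^ M →
      S (suc c' * (W M * W M)) + S (suc (2 * c')) ≡ S c' + M * t + S (suc c')
    s-multiple-W² M c' 2c≤q^M = begin
        S (suc c' * (W M * W M)) + S (2c-1)
      ≡⟨ cong (λ u → S (suc c' * (u * u)) + S (2c-1)) W≡z+2c-1 ⟩
        S (suc c' * ((z + 2c-1) * (z + 2c-1))) + S (2c-1)
      ≡⟨ cong (λ u → S u + S (2c-1)) (expand z c') ⟩
        S (suc c' + suc (z + 2c-1) * (z + suc (z + 2c-1) * c')) + S (2c-1)
      ≡⟨ cong (λ u → S (suc c' + u * (z + u * c')) + S (2c-1)) 1+W≡q^M ⟩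
        S (suc c' + q ^ M * (z + q ^ M * c')) + S (2c-1)
      ≡⟨ cong (_+ S (2c-1)) (s-concat M (suc c') _ c<q^M) ⟩
        (S (suc c') + S (z + q ^ M * c')) + S (2c-1)
      ≡⟨ cong (λ u → (S (suc c') + u) + S (2c-1)) (s-concat M z c' z<q^M) ⟩
        (S (suc c') + (S z + S c')) + S (2c-1)
      ≡⟨ rearrange (S (suc c')) (S z) (S c') (S (2c-1)) ⟩
        S c' + (S z + S (2c-1)) + S (suc c')
      ≡⟨ cong (λ u → S c' + u + S (suc c')) (s-complement M z (2c-1) (sym W≡z+2c-1)) ⟩
        S c' + M * t + S (suc c') ∎
      where
      open ≡-Reasoning
      2c-1 = suc (2 * c')
      z = q ^ M ∸ 2 * suc c'
      W≡z+2c-1 : W M ≡ z + 2c-1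
      W≡z+2c-1 = cong pred (trans (sym (m∸n+n≡m 2c≤q^M)) (shift z c'))
        where
        shift : ∀ z c → z + 2 * suc c ≡ suc (z + suc (2 * c))
        shift = solve-∀
      1+W≡q^M : suc (z + 2c-1) ≡ q ^ M
      1+W≡q^M = trans (cong suc (sym W≡z+2c-1)) (sym (q^M≡1+W M))
      c<q^M : suc c' < q ^ M
      c<q^M = <-≤-trans (m<m+n (suc c') (s≤s z≤n)) 2c≤q^M
      z<q^M : z < q ^ M
      z<q^M = subst (z <_) (m∸n+n≡m 2c≤q^M) (m<m+n z (s≤s z≤n))
      expand : ∀ z c → suc c * ((z + suc (2 * c)) * (z + suc (2 * c))) ≡
                       suc c + suc (z + suc (2 * c)) * (z + suc (z + suc (2 * c)) * c)
      expand = solve-∀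
      rearrange : ∀ a b c d → (a + (b + c)) + d ≡ c + (b + d) + a
      rearrange = solve-∀

    s-evalP : ∀ L cs → All (_< q ^ L) cs → S (evalP (q ^ L) cs) ≡ sum (map S cs)
    s-evalP L []       []           = refl
    s-evalP L (c ∷ cs) (c<q^L ∷ cs<q^L) =
      trans (s-concat L c (evalP (q ^ L) cs) c<q^L) (cong (S c +_) (s-evalP L cs cs<q^L))

    -- 's-multiple-W²' with every digit sum s(m) replaced by m - t·j(m).
    s-multiple-W²-j : ∀ M c → 2 * suc c ≤ q ^ M →
      S (suc c * (W M * W M)) + t * (j c + j (suc c)) ≡ t * (M + j (suc (2 * c)))
    s-multiple-W²-j M c 2c≤q^M = +-cancelʳ-≡ (suc (2 * c)) _ _ (begin
        (x + t * (j₀ + j₁)) + suc (2 * c)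
      ≡⟨ cong ((x + t * (j₀ + j₁)) +_) (sym (s+tj≡id (suc (2 * c)))) ⟩
        (x + t * (j₀ + j₁)) + (S (suc (2 * c)) + t * j₂)
      ≡⟨ regroup₁ x t j₀ j₁ (S (suc (2 * c))) j₂ ⟩
        (x + S (suc (2 * c))) + (t * j₀ + t * j₁ + t * j₂)
      ≡⟨ cong (_+ (t * j₀ + t * j₁ + t * j₂)) (s-multiple-W² M c 2c≤q^M) ⟩
        (S c + M * t + S (suc c)) + (t * j₀ + t * j₁ + t * j₂)
      ≡⟨ regroup₂ (S c) M t (S (suc c)) j₀ j₁ j₂ ⟩
        (S c + t * j₀) + (S (suc c) + t * j₁) + t * (M + j₂)
      ≡⟨ cong₂ (λ u v → u + v + t * (M + j₂)) (s+tj≡id c) (s+tj≡id (suc c)) ⟩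
        c + suc c + t * (M + j₂)
      ≡⟨ regroup₃ c t M j₂ ⟩
        t * (M + j₂) + suc (2 * c) ∎)
      where
      open ≡-Reasoning
      x  = S (suc c * (W M * W M))
      j₀ = j c
      j₁ = j (suc c)
      j₂ = j (suc (2 * c))
      regroup₁ : ∀ x t j₀ j₁ e j₂ → (x + t * (j₀ + j₁)) + (e + t * j₂) ≡ (x + e) + (t * j₀ + t * j₁ + t * j₂)
      regroup₁ = solve-∀
      regroup₂ : ∀ e₀ M t e₁ j₀ j₁ j₂ →
        (e₀ + M * t + e₁) + (t * j₀ + t * j₁ + t * j₂) ≡ (e₀ + t * j₀) + (e₁ + t * j₁) + t * (M + j₂)
      regroup₂ = solve-∀
      regroup₃ : ∀ c t M j₂ → c + suc c + t * (M + j₂) ≡ t * (M + j₂) + suc (2 * c)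
      regroup₃ = solve-∀

    lowJ highJ : List ℕ → ℕ
    lowJ []           = 0
    lowJ (zero  ∷ cs) = lowJ cs
    lowJ (suc c ∷ cs) = j c + j (suc c) + lowJ cs
    highJ []           = 0
    highJ (zero  ∷ cs) = highJ cs
    highJ (suc c ∷ cs) = j (suc (2 * c)) + highJ cs

    s-square-blocks : ∀ M cs → All (λ c → 2 * c ≤ q ^ M) cs →
      sum (map S (scale (W M * W M) cs)) + t * lowJ cs ≡ t * (nonzeros cs * M + highJ cs)
    s-square-blocks M []           []           = refl
    s-square-blocks M (zero  ∷ cs) (_ ∷ bounds) = s-square-blocks M cs bounds
    s-square-blocks M (suc c ∷ cs) (2c≤q^M ∷ bounds) = begin
        (x + sum (map S (scale (W M * W M) cs))) + t * (jc + lowJ cs)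
      ≡⟨ regroup₁ x (sum (map S (scale (W M * W M) cs))) t jc (lowJ cs) ⟩
        (x + t * jc) + (sum (map S (scale (W M * W M) cs)) + t * lowJ cs)
      ≡⟨ cong₂ _+_ (s-multiple-W²-j M c 2c≤q^M) (s-square-blocks M cs bounds) ⟩
        t * (M + j (suc (2 * c))) + t * (nonzeros cs * M + highJ cs)
      ≡⟨ regroup₂ t M (j (suc (2 * c))) (nonzeros cs) (highJ cs) ⟩
        t * (suc (nonzeros cs) * M + (j (suc (2 * c)) + highJ cs)) ∎
      where
      open ≡-Reasoning
      x  = S (suc c * (W M * W M))
      jc = j c + j (suc c)
      regroup₁ : ∀ x y t a b → (x + y) + t * (a + b) ≡ (x + t * a) + (y + t * b)
      regroup₁ = solve-∀
      regroup₂ : ∀ t M h n hs → t * (M + h) + t * (n * M + hs) ≡ t * ((M + n * M) + (h + hs))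
      regroup₂ = solve-∀

    s-multiple-blocks : ∀ M v cs → 1 ≤ v → All (λ c → c * v ≤ q ^ M) cs →
      sum (map S (scale (v * W M) cs)) ≡ t * (nonzeros cs * M)
    s-multiple-blocks M v []           _   []                 = sym (*-zeroʳ t)
    s-multiple-blocks M v (zero  ∷ cs) 1≤v (_ ∷ bounds)       = s-multiple-blocks M v cs 1≤v bounds
    s-multiple-blocks M v (suc c ∷ cs) 1≤v (cv≤q^M ∷ bounds) = begin
        S (suc c * (v * W M)) + sum (map S (scale (v * W M) cs))
      ≡⟨ cong₂ (λ u w → S u + w) (sym (*-assoc (suc c) v (W M))) (s-multiple-blocks M v cs 1≤v bounds) ⟩
        S (suc c * v * W M) + t * (nonzeros cs * M)
      ≡⟨ cong (_+ t * (nonzeros cs * M)) (s-multiple-W M (suc c * v) (*-mono-≤ {1} {suc c} (s≤s z≤n) 1≤v) cv≤q^M) ⟩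
        M * t + t * (nonzeros cs * M)
      ≡⟨ regroup M t (nonzeros cs) ⟩
        t * (M + nonzeros cs * M) ∎
      where
      open ≡-Reasoning
      regroup : ∀ M t n → M * t + t * (n * M) ≡ t * (M + n * M)
      regroup = solve-∀

    lowJ-total highJ-total : ℕ
    lowJ-total  = lowJ P²Coeffs + lowJ tailCoeffs
    highJ-total = highJ P²Coeffs + highJ tailCoeffs

    -- The number u for lengths M₁, M₂, L, with a = q^M₁ - 1, b = q^M₂ - 1 and base X = q^L.
    -- The growth conditions make every block of u and u² a single base-X digit.
    module Construction (M₁ M₂ L : ℕ) (5≤M₁ : 5 ≤ M₁) (M₁+3≤M₂ : M₁ + 3 ≤ M₂) (2M₂+4≤L : 2 * M₂ + 4 ≤ L) where

      -- z = a - 2 and e = X - a are the numbers needed to write a·P(X) in blocks.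
      a b X z e K² : ℕ
      a  = W M₁
      b  = W M₂
      X  = q ^ L
      z  = q ^ M₁ ∸ 3
      e  = X ∸ a
      K² = q ^ M₂ * q ^ M₂

      u : ℕ
      u = evalP X (uBlocks a (suc z) e b)

      32≤q^M₁ : 32 ≤ q ^ M₁
      32≤q^M₁ = ≤-trans (^-monoˡ-≤ 5 1<q) (^-monoʳ-≤ q 5≤M₁)

      22≤q^M₂ : 22 ≤ q ^ M₂
      22≤q^M₂ = ≤-trans (m≤m+n 22 10) (≤-trans 32≤q^M₁ (^-monoʳ-≤ q (≤-trans (m≤m+n M₁ 3) M₁+3≤M₂)))

      q^M₁≡3+z : q ^ M₁ ≡ 3 + z
      q^M₁≡3+z = trans (sym (m∸n+n≡m (≤-trans (m≤m+n 3 29) 32≤q^M₁))) (+-comm z 3)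

      a≡2+z : a ≡ suc (suc z)
      a≡2+z = cong pred q^M₁≡3+z

      8q^M₁≤q^M₂ : 8 * q ^ M₁ ≤ q ^ M₂
      8q^M₁≤q^M₂ = ≤-trans (*-monoˡ-≤ (q ^ M₁) (^-monoˡ-≤ 3 1<q))
                     (≤-trans (≤-reflexive (sym (^-distribˡ-+-* q 3 M₁)))
                              (^-monoʳ-≤ q (≤-trans (≤-reflexive (+-comm 3 M₁)) M₁+3≤M₂)))

      a<q^M₁ : a < q ^ M₁
      a<q^M₁ = subst (a <_) (sym (q^M≡1+W M₁)) ≤-refl

      a≤K : a ≤ q ^ M₂
      a≤K = ≤-trans (<⇒≤ a<q^M₁) (≤-trans (m≤n*m (q ^ M₁) 8) 8q^M₁≤q^M₂)

      b≤K : b ≤ q ^ M₂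
      b≤K = subst (b ≤_) (sym (q^M≡1+W M₂)) (n≤1+n b)

      below-X : ∀ {x} → x ≤ 11 * K² → x < X
      below-X {x} x≤11K² = begin-strict
          x
        ≤⟨ x≤11K² ⟩
          11 * K²
        <⟨ *-monoˡ-< K² {{m*n≢0 (q ^ M₂) (q ^ M₂) {{m^n≢0 q M₂}} {{m^n≢0 q M₂}}}} (s≤s (m≤m+n 11 4)) ⟩
          16 * K²
        ≤⟨ *-monoˡ-≤ K² (^-monoˡ-≤ 4 1<q) ⟩
          q ^ 4 * K²
        ≡⟨ cong (q ^ 4 *_) (sym (^-distribˡ-+-* q M₂ M₂)) ⟩
          q ^ 4 * q ^ (M₂ + M₂)
        ≡⟨ sym (^-distribˡ-+-* q 4 (M₂ + M₂)) ⟩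
          q ^ (4 + (M₂ + M₂))
        ≤⟨ ^-monoʳ-≤ q (≤-trans (≤-reflexive (exponent M₂)) 2M₂+4≤L) ⟩
          X ∎
        where
        open ≤-Reasoning
        exponent : ∀ m → 4 + (m + m) ≡ 2 * m + 4
        exponent = solve-∀

      scaled-below-X : ∀ m cs → m ≤ K² → All (_≤ 11) cs → All (_< X) (scale m cs)
      scaled-below-X m cs m≤K² cs≤11 = map⁺ (All-map (λ c≤11 → below-X (*-mono-≤ c≤11 m≤K²)) cs≤11)

      ≤11K² : ∀ {x} → x ≤ q ^ M₂ → x ≤ 11 * K²
      ≤11K² x≤K = ≤-trans (≤-trans x≤K (m≤m*n (q ^ M₂) (q ^ M₂) {{m^n≢0 q M₂}})) (m≤n*m K² 11)

      X≡e+a : X ≡ e + a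
      X≡e+a = sym (m∸n+n≡m (<⇒≤ (below-X (≤11K² a≤K))))

      uBlocks-below-X : All (_< X) (uBlocks a (suc z) e b)
      uBlocks-below-X =
        below-X (≤11K² a≤K) ∷ below-X (≤11K² 2a≤K) ∷ e<X ∷ below-X (≤11K² (≤-trans 2a-1≤2a 2a≤K)) ∷
        below-X (≤11K² a≤K) ∷ 0<X ∷ 0<X ∷ 0<X ∷ 0<X ∷ below-X (≤11K² b≤K) ∷ below-X (≤11K² b≤K) ∷ []
        where
        0<X : 0 < X
        0<X = m^n>0 q L
        2a≤K : 2 * a ≤ q ^ M₂
        2a≤K = ≤-trans (*-monoʳ-≤ 2 (<⇒≤ a<q^M₁)) (≤-trans (*-monoˡ-≤ (q ^ M₁) (m≤m+n 2 6)) 8q^M₁≤q^M₂)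
        e<X : e < X
        e<X = subst (e <_) (sym X≡e+a) (m<m+n e (subst (0 <_) (sym a≡2+z) (s≤s z≤n)))
        2a-1≤2a : suc (2 * suc z) ≤ 2 * a
        2a-1≤2a = subst (λ v → suc (2 * suc z) ≤ 2 * v) (sym a≡2+z) (subst (suc (2 * suc z) ≤_) (double z) (n≤1+n _))
          where
          double : ∀ z → suc (suc (2 * suc z)) ≡ 2 * suc (suc z)
          double = solve-∀

      -- The blocks X - a and 2a - 1 together contribute (L + j(2))·t:
      -- s(X - a) = Lt - s(a - 1) = Lt - (M₁t - 1) and s(2a - 1) = s(a - 2) + 1 = M₁t - s(2) + 1.
      s-middle-blocks : S e + S (suc (2 * suc z)) ≡ t * (L + j 2)
      s-middle-blocks = +-cancelʳ-≡ (S (suc z) + S 2) _ _ (begin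
          (S e + S (suc (2 * suc z))) + (S (suc z) + S 2)
        ≡⟨ cong (λ v → (S e + v) + (S (suc z) + S 2)) s-2a-1 ⟩
          (S e + (S z + 1)) + (S (suc z) + S 2)
        ≡⟨ regroup₁ (S e) (S z) (S (suc z)) (S 2) ⟩
          (S e + S (suc z)) + (S z + S 2) + 1
        ≡⟨ cong₂ (λ u v → u + v + 1) s-e+s-a-1 s-a-2+s-2 ⟩
          L * t + M₁ * t + 1
        ≡⟨ cong (λ v → L * t + v + 1) (sym s-a-1+1) ⟩
          L * t + (S (suc z) + 1) + 1
        ≡⟨ regroup₂ L t (S (suc z)) ⟩
          t * L + S (suc z) + 2
        ≡⟨ cong (t * L + S (suc z) +_) (sym (s+tj≡id 2)) ⟩
          t * L + S (suc z) + (S 2 + t * j 2)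
        ≡⟨ regroup₃ t L (S (suc z)) (S 2) (j 2) ⟩
          t * (L + j 2) + (S (suc z) + S 2) ∎)
        where
        open ≡-Reasoning
        -- 2a - 1 = (a - 2) + q^M₁: the digits of a - 2 followed by a single 1
        s-2a-1 : S (suc (2 * suc z)) ≡ S z + 1
        s-2a-1 = trans (cong S (trans (shift z) (cong (λ v → z + v * 1) (sym q^M₁≡3+z))))
                       (s-concat M₁ z 1 (subst (z <_) (sym q^M₁≡3+z) (m<n+m z (s≤s z≤n))))
          where
          shift : ∀ z → suc (2 * suc z) ≡ z + (3 + z) * 1
          shift = solve-∀
        s-e+s-a-1 : S e + S (suc z) ≡ L * t
        s-e+s-a-1 = s-complement L e (suc z) (cong pred (trans (sym (+-suc e (suc z))) (trans (cong (e +_) (sym a≡2+z)) (sym X≡e+a))))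
        s-a-2+s-2 : S z + S 2 ≡ M₁ * t
        s-a-2+s-2 = s-complement M₁ z 2 (trans (+-comm z 2) (sym a≡2+z))
        s-a-1+1 : S (suc z) + 1 ≡ M₁ * t
        s-a-1+1 = s-complement M₁ (suc z) 1 (trans (+-comm (suc z) 1) (sym a≡2+z))
        regroup₁ : ∀ e z z' w → (e + (z + 1)) + (z' + w) ≡ (e + z') + (z + w) + 1
        regroup₁ = solve-∀
        regroup₂ : ∀ L t y → L * t + (y + 1) + 1 ≡ t * L + y + 2
        regroup₂ = solve-∀
        regroup₃ : ∀ t L y w j → t * L + y + (w + t * j) ≡ t * (L + j) + (y + w)
        regroup₃ = solve-∀

      -- s(u): blocks a, 2a, a (M₁t each), b, b (M₂t each) and the two middle blocks.
      s-u : S u ≡ t * (L + 3 * M₁ + 2 * M₂ + j 2)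
      s-u = begin
          S u
        ≡⟨ s-evalP L (uBlocks a (suc z) e b) uBlocks-below-X ⟩
          S a + (S (2 * a) + (S e + (S (suc (2 * suc z)) + (S a + (S b + (S b + 0))))))
        ≡⟨ regroup (S a) (S (2 * a)) (S e) (S (suc (2 * suc z))) (S b) ⟩
          (S e + S (suc (2 * suc z))) + (S a + S (2 * a) + S a + S b + S b)
        ≡⟨ cong₂ _+_ s-middle-blocks
             (cong₂ _+_ (cong₂ _+_ (cong₂ _+_ (cong₂ _+_ (s-W M₁) s-2a) (s-W M₁)) (s-W M₂)) (s-W M₂)) ⟩
          t * (L + j 2) + (M₁ * t + M₁ * t + M₁ * t + M₂ * t + M₂ * t)
        ≡⟨ collect t L (j 2) M₁ M₂ ⟩
          t * (L + 3 * M₁ + 2 * M₂ + j 2) ∎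
        where
        open ≡-Reasoning
        s-2a : S (2 * a) ≡ M₁ * t
        s-2a = s-multiple-W M₁ 2 (s≤s z≤n) (≤-trans (m≤m+n 2 30) 32≤q^M₁)
        regroup : ∀ x y e m w → x + (y + (e + (m + (x + (w + (w + 0)))))) ≡ (e + m) + (x + y + x + w + w)
        regroup = solve-∀
        collect : ∀ t L j M₁ M₂ → t * (L + j) + (M₁ * t + M₁ * t + M₁ * t + M₂ * t + M₂ * t) ≡ t * (L + 3 * M₁ + 2 * M₂ + j)
        collect = solve-∀

      -- u² = a²·P(X)² + X⁹·(ab·2P(X)(1+X) + X⁹·b²·(1+X)²) blockwise: seven blocks
      -- c·a² (M₁-digit squares), six blocks c·a·b (multiples of b) and three blocks c·b².
      s-u² : S (u * u) + t * lowJ-total ≡ t * (7 * M₁ + 9 * M₂ + highJ-total)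
      s-u² = begin
          S (u * u) + t * lowJ-total
        ≡⟨ cong (λ v → S v + t * lowJ-total) (u²-blocks a (suc z) e b X a≡2+z X≡e+a) ⟩
          S (evalP X (u²Blocks a b)) + t * lowJ-total
        ≡⟨ cong (_+ t * lowJ-total) (trans (s-evalP L (u²Blocks a b) u²Blocks-below-X) three-parts) ⟩
          (σ₁ + (σ₂ + σ₃)) + t * (lowJ P²Coeffs + lowJ tailCoeffs)
        ≡⟨ regroup σ₁ σ₂ σ₃ t (lowJ P²Coeffs) (lowJ tailCoeffs) ⟩
          (σ₁ + t * lowJ P²Coeffs) + σ₂ + (σ₃ + t * lowJ tailCoeffs)
        ≡⟨ cong₂ _+_ (cong₂ _+_ (s-square-blocks M₁ P²Coeffs P²-small)
                                 (s-multiple-blocks M₂ a crossCoeffs 1≤a cross-small))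
                     (s-square-blocks M₂ tailCoeffs tail-small) ⟩
          t * (7 * M₁ + highJ P²Coeffs) + t * (6 * M₂) + t * (3 * M₂ + highJ tailCoeffs)
        ≡⟨ collect t M₁ M₂ (highJ P²Coeffs) (highJ tailCoeffs) ⟩
          t * (7 * M₁ + 9 * M₂ + highJ-total) ∎
        where
        open ≡-Reasoning
        σ₁ σ₂ σ₃ : ℕ
        σ₁ = sum (map S (scale (a * a) P²Coeffs))
        σ₂ = sum (map S (scale (a * b) crossCoeffs))
        σ₃ = sum (map S (scale (b * b) tailCoeffs))
        three-parts : sum (map S (u²Blocks a b)) ≡ σ₁ + (σ₂ + σ₃)
        three-parts = trans (sum-map-++ S (scale (a * a) P²Coeffs) (scale (a * b) crossCoeffs ++ scale (b * b) tailCoeffs))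
                            (cong (σ₁ +_) (sum-map-++ S (scale (a * b) crossCoeffs) (scale (b * b) tailCoeffs)))
        u²Blocks-below-X : All (_< X) (u²Blocks a b)
        u²Blocks-below-X = ++⁺ (scaled-below-X (a * a) P²Coeffs (*-mono-≤ a≤K a≤K) (from-yes (all? (_≤? 11) P²Coeffs)))
                          (++⁺ (scaled-below-X (a * b) crossCoeffs (*-mono-≤ a≤K b≤K) (from-yes (all? (_≤? 11) crossCoeffs)))
                               (scaled-below-X (b * b) tailCoeffs (*-mono-≤ b≤K b≤K) (from-yes (all? (_≤? 11) tailCoeffs))))
        P²-small : All (λ c → 2 * c ≤ q ^ M₁) P²Coeffs
        P²-small = All-map (λ c≤11 → ≤-trans (*-monoʳ-≤ 2 c≤11) (≤-trans (m≤m+n 22 10) 32≤q^M₁)) (from-yes (all? (_≤? 11) P²Coeffs))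
        tail-small : All (λ c → 2 * c ≤ q ^ M₂) tailCoeffs
        tail-small = All-map (λ c≤11 → ≤-trans (*-monoʳ-≤ 2 c≤11) 22≤q^M₂) (from-yes (all? (_≤? 11) tailCoeffs))
        cross-small : All (λ c → c * a ≤ q ^ M₂) crossCoeffs
        cross-small = All-map (λ c≤8 → ≤-trans (*-mono-≤ c≤8 (<⇒≤ a<q^M₁)) 8q^M₁≤q^M₂) (from-yes (all? (_≤? 8) crossCoeffs))
        1≤a : 1 ≤ a
        1≤a = subst (1 ≤_) (sym a≡2+z) (s≤s z≤n)
        regroup : ∀ x y w t p r → (x + (y + w)) + t * (p + r) ≡ (x + t * p) + y + (w + t * r)
        regroup = solve-∀
        collect : ∀ t M₁ M₂ h h' → t * (7 * M₁ + h) + t * (6 * M₂) + t * (3 * M₂ + h') ≡ t * (7 * M₁ + 9 * M₂ + (h + h'))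
        collect = solve-∀

    ratio-from-lengths : ∀ {n d} → 0 < d → Lengths lowJ-total highJ-total (j 2) n d →
      ∃ λ u → 0 < S u × S (u ^ 2) * d ≡ n * S u
    ratio-from-lengths {n} {d} 0<d ℓ = u , 0<s-u , ratio
      where
      open Lengths ℓ
      open Construction M₁ M₂ L 5≤M₁ M₁+3≤M₂ 2M₂+4≤L
      open ≡-Reasoning
      s-u²≡tnN : S (u ^ 2) ≡ t * (n * N)
      s-u²≡tnN = +-cancelʳ-≡ (t * lowJ-total) (S (u ^ 2)) (t * (n * N)) (begin
          S (u ^ 2) + t * lowJ-total
        ≡⟨ cong (λ v → S (u * v) + t * lowJ-total) (*-identityʳ u) ⟩
          S (u * u) + t * lowJ-total
        ≡⟨ s-u² ⟩
          t * (7 * M₁ + 9 * M₂ + highJ-total)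
        ≡⟨ cong (t *_) square-eq ⟩
          t * (lowJ-total + n * N)
        ≡⟨ swap t lowJ-total (n * N) ⟩
          t * (n * N) + t * lowJ-total ∎)
        where
        swap : ∀ t P m → t * (P + m) ≡ t * m + t * P
        swap = solve-∀
      s-u≡tdN : S u ≡ t * (d * N)
      s-u≡tdN = trans s-u (cong (t *_) root-eq)
      0<s-u : 0 < S u
      0<s-u = subst (0 <_) (sym s-u≡tdN) (*-mono-< {0} {t} {0} {d * N} (s≤s z≤n) (*-mono-< {0} {d} {0} {N} 0<d 1≤N))
      ratio : S (u ^ 2) * d ≡ n * S u
      ratio = begin
          S (u ^ 2) * d        ≡⟨ cong (_* d) s-u²≡tnN ⟩
          t * (n * N) * d      ≡⟨ rearrange t n N d ⟩
          n * (t * (d * N))    ≡⟨ cong (n *_) (sym s-u≡tdN) ⟩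
          n * S u ∎
        where
        rearrange : ∀ t n N d → t * (n * N) * d ≡ n * (t * (d * N))
        rearrange = solve-∀

    realise-ratio : ∀ n d → 0 < n → n < d → ∃ λ u → 0 < S u × S (u ^ 2) * d ≡ n * S u
    realise-ratio n d 0<n n<d =
      ratio-from-lengths (<-trans 0<n n<d) (choose-lengths lowJ-total highJ-total (j 2) n d (j≤id 2) 0<n n<d)

open import Data.Nat using (ℕ; zero; suc; z≤n; s≤s; _≤_; _^_; NonZero)
import Data.Nat as ℕ
import Data.Nat.Properties as ℕₚ
open import Data.Nat.Coprimality using (Coprime)
open import Data.Product using (∃; _×_; _,_)
open import Relation.Binary.PropositionalEquality
open import Data.Integer as ℤ using (+_)
import Data.Integer.Properties as ℤ
open import Data.Rational using (ℚ; mkℚ; 0ℚ; 1ℚ; _<_; *<*; _*_; _/_; toℚᵘ)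
open import Data.Rational.Properties using (toℚᵘ-injective; toℚᵘ-fromℚᵘ; toℚᵘ-homo-*)
import Data.Rational.Unnormalised as ℚᵘ
import Data.Rational.Unnormalised.Properties as ℚᵘ
open DigitSumsOfSquares using (module DigitSums)

cross-multiplied : ∀ A B n d-1 .{c : Coprime n (suc d-1)} →
  A ℕ.* suc d-1 ≡ n ℕ.* B → (+ A) / 1 ≡ mkℚ (+ n) d-1 c * ((+ B) / 1)
cross-multiplied A B n d-1 {c} A*d≡n*B = toℚᵘ-injective (begin
    toℚᵘ ((+ A) / 1)                        ≈⟨ toℚᵘ-fromℚᵘ (ℚᵘ.mkℚᵘ (+ A) 0) ⟩
    ℚᵘ.mkℚᵘ (+ A) 0                        ≈⟨ ℚᵘ.*≡* cross ⟩
    toℚᵘ r ℚᵘ.* ℚᵘ.mkℚᵘ (+ B) 0            ≈⟨ ℚᵘ.*-congˡ {toℚᵘ r} (ℚᵘ.≃-sym (toℚᵘ-fromℚᵘ (ℚᵘ.mkℚᵘ (+ B) 0))) ⟩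
    toℚᵘ r ℚᵘ.* toℚᵘ ((+ B) / 1)           ≈⟨ ℚᵘ.≃-sym (toℚᵘ-homo-* r ((+ B) / 1)) ⟩
    toℚᵘ (r * ((+ B) / 1)) ∎)
  where
  open ℚᵘ.≃-Reasoning
  r : ℚ
  r = mkℚ (+ n) d-1 c
  cross : + A ℤ.* (+ suc d-1 ℤ.* + 1) ≡ (+ n ℤ.* + B) ℤ.* + 1
  cross = trans (cong (+ A ℤ.*_) (ℤ.*-identityʳ (+ suc d-1)))
         (trans (sym (ℤ.pos-* A (suc d-1)))
         (trans (cong +_ A*d≡n*B)
         (trans (ℤ.pos-* n B) (sym (ℤ.*-identityʳ _)))))

theorem3p3 : (q : ℕ) → .{{_ : NonZero q}} → 2 ≤ q → (r : ℚ) → 0ℚ < r → r < 1ℚ →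
    ∃ λ (u : ℕ) → s q u ≢ 0 × (+ s q (u ^ 2)) / 1 ≡ r * ((+ s q u) / 1)
theorem3p3 (suc zero)    (s≤s ())
theorem3p3 (suc (suc k)) _ (mkℚ (+ zero) _ _) (*<* (ℤ.+<+ ()))
theorem3p3 (suc (suc k)) _ r@(mkℚ (+ suc n') d-1 _) _ (*<* (ℤ.+<+ n<d)) =
  conclude (realise-ratio (suc n') (suc d-1) (s≤s z≤n) n<d′)
  where
  open DigitSums k
  n<d′ : suc n' ℕ.< suc d-1
  n<d′ = subst₂ ℕ._<_ (ℕₚ.*-identityʳ (suc n')) (ℕₚ.*-identityˡ (suc d-1)) n<d
  conclude : (∃ λ u → 0 ℕ.< S u × S (u ^ 2) ℕ.* suc d-1 ≡ suc n' ℕ.* S u) →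
             ∃ λ u → S u ≢ 0 × (+ S (u ^ 2)) / 1 ≡ r * ((+ S u) / 1)
  conclude (u , 0<s-u , ratio) = u , ℕₚ.>⇒≢ 0<s-u , cross-multiplied (S (u ^ 2)) (S u) (suc n') d-1 ratio
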